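{- Let $m>2$ be odd and $n>0$ be even, with $\gcd(m,n)=1$. Then a tuple $\mathbf{a}=(a_0,\dots,a_{n-1})\in\mathbf{Z}_m^n$ belongs to a cycle of $T$ if and only if $\sigma(\mathbf{a})=\sum_{i=0}^{n-1}(-1)^ia_i\equiv 0\pmod m$.
   Context: $\mathbf{Z}_m$ is the ring of integers modulo $m$; $T:\mathbf{Z}_m^n\to\mathbf{Z}_m^n$ is $T(a_0,\dots,a_{n-1})=(a_0+a_1,a_1+a_2,\dots,a_{n-2}+a_{n-1},a_{n-1}+a_0)$. A tuple $\mathbf{a}$ belongs to a cycle if $T^{j}\mathbf{a}=\mathbf{a}$ for some positive integer $j$. -}

module Defs where

open import Data.Nat using (ℕ; zero; suc; _+_; _%_; NonZero)
open import Data.Fin using (Fin; toℕ; fromℕ<)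
open import Data.Nat.DivMod using (m%n<n)
open import Data.Integer as ℤ using (ℤ; +_)
open import Data.Nat.Properties using (+-suc)
open import Function using (_∘_; id)
open import Relation.Binary.PropositionalEquality using (_≡_)
open import Data.Product using (∃-syntax; _×_)

Zmod : ℕ → Set
Zmod m = Fin m

_+ₘ_ : ∀ {m} .{{_ : NonZero m}} → Zmod m → Zmod m → Zmod m
_+ₘ_ {m} x y = fromℕ< (m%n<n (toℕ x + toℕ y) m)

Tuple : ℕ → ℕ → Set
Tuple m n = Fin n → Zmod m

nextIdx : ∀ {n} .{{_ : NonZero n}} → Fin n → Fin n
nextIdx {n} i = fromℕ< (m%n<n (suc (toℕ i)) n)

T : ∀ {m n} .{{_ : NonZero m}} .{{_ : NonZero n}} → Tuple m n → Tuple m n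
T a i = a i +ₘ a (nextIdx i)

iter : ∀ {A : Set} → ℕ → (A → A) → A → A
iter zero f x = x
iter (suc k) f x = f (iter k f x)

InCycle : ∀ {m n} .{{_ : NonZero m}} .{{_ : NonZero n}} → Tuple m n → Set
InCycle a = ∃[ j ] (0 Data.Nat.< j × (∀ i → iter j T a i ≡ a i))
  where import Data.Nat

σ : ∀ {m n} → Tuple m n → ℤ
σ {n = zero} a = + 0
σ {n = suc n} a = (+ toℕ (a Fin.zero)) ℤ.- σ (a ∘ Fin.suc)
  where import Data.Fin as Fin

{-# OPTIONS --safe #-}
-- For even n the alternating sum of T b is Σ (-1)^i (b_i + b_{i+1}) = 0, so T maps every
-- tuple into ker σ; a tuple on a cycle is the image of its predecessor, hence σ a ≡ 0.
-- Conversely T is injective on ker σ: if T a = T b then d = a - b satisfies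
-- d_{i+1} ≡ -d_i, so σ d ≡ n d_0, and gcd(m,n) = 1 forces d_0 ≡ 0 and then d ≡ 0.
-- An injective self-map of the finite set ker σ is a permutation, so every point of
-- ker σ lies on a cycle.
module Submission where

open import Defs
open import Data.Nat using (ℕ; _>_; _%_; NonZero)
open import Data.Nat.GCD using (gcd)
open import Data.Integer using (+_)
open import Data.Integer.Divisibility using (_∣_)
open import Relation.Binary.PropositionalEquality using (_≡_)
open import Function.Bundles using (_⇔_)

open import Data.Nat as ℕ using (zero; suc; _<_; s<s)
import Data.Nat.Properties as ℕ
import Data.Nat.DivMod as ℕ
open import Data.Nat.Divisibility using (>⇒∤) renaming (_∣_ to _∣ℕ_)
open import Data.Nat.Coprimality using (Coprime; gcd≡1⇒coprime)
open import Data.Fin as Fin using (Fin; toℕ; inject₁; fromℕ; funToFin; finToFun)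
import Data.Fin.Properties as Fin
open import Data.Integer as ℤ using (ℤ; -_; _+_; _-_; _*_; ∣_∣)
import Data.Integer.Properties as ℤ
import Data.Integer.DivMod as ℤ
import Data.Integer.Coprimality as ℤ
open import Data.Integer.Divisibility.Signed
  using (divides; ∣ᵤ⇒∣; ∣⇒∣ᵤ; ∣m⇒∣-m; ∣n⇒∣m*n; ∣m∣n⇒∣m-n; ∣m+n∣m⇒∣n)
  renaming (_∣_ to _∣ₛ_)
open import Data.Integer.Tactic.RingSolver using (solve-∀)
open import Data.Product using (_,_; _×_; ∃-syntax)
open import Function using (_∘_; mk⇔)
open import Function.Definitions using (Injective)
open import Level using (0ℓ)
open import Relation.Binary.Bundles using (Setoid)
open import Relation.Binary.PropositionalEquality
  using (refl; sym; trans; cong; cong₂; subst; subst₂; _≗_; _→-setoid_; module ≡-Reasoning)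
open import Relation.Nullary using (contradiction)
open import Relation.Unary using (Pred)

infix 4 _≡_[mod_]

_≡_[mod_] : ℤ → ℤ → ℕ → Set
x ≡ y [mod m ] = + m ∣ₛ x - y

⟦_⟧ : ∀ {m} → Zmod m → ℤ
⟦ x ⟧ = + toℕ x

multiple<⇒≡0 : ∀ {m k} → m ∣ℕ k → k < m → k ≡ 0
multiple<⇒≡0 {k = zero}  _   _   = refl
multiple<⇒≡0 {k = suc _} m∣k k<m = contradiction m∣k (>⇒∤ k<m)

module _ {m : ℕ} .{{_ : NonZero m}} where

  n%m≡n-mod : ∀ n → + (n % m) ≡ + n [mod m ]
  n%m≡n-mod n = divides (- + (n ℕ./ m)) (begin
      r - + n                    ≡⟨ cong (_-_ r) (ℤ.a≡a%ℕn+[a/ℕn]*n (+ n) m) ⟩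
      r - (r + q * + m)          ≡⟨ cancel r q (+ m) ⟩
      - q * + m                  ∎)
    where
    open ≡-Reasoning
    r = + (n % m)
    q = + (n ℕ./ m)
    cancel : ∀ r q m → r - (r + q * m) ≡ - q * m
    cancel = solve-∀

  ⟦+ₘ⟧ : (x y : Zmod m) → ⟦ x +ₘ y ⟧ ≡ ⟦ x ⟧ + ⟦ y ⟧ [mod m ]
  ⟦+ₘ⟧ x y = subst₂ _≡_[mod m ] (cong +_ (sym (Fin.toℕ-fromℕ< _))) (ℤ.pos-+ (toℕ x) (toℕ y))
    (n%m≡n-mod (toℕ x ℕ.+ toℕ y))

  ⟦⟧-injective-mod : ∀ {x y : Zmod m} → ⟦ x ⟧ ≡ ⟦ y ⟧ [mod m ] → x ≡ y
  ⟦⟧-injective-mod {x} {y} x≡y = Fin.toℕ-injective (ℤ.+-injective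
    (ℤ.i-j≡0⇒i≡j _ _ (ℤ.∣i∣≡0⇒i≡0 (multiple<⇒≡0 (∣⇒∣ᵤ x≡y) distance<m))))
    where
    distance<m : ∣ ⟦ x ⟧ - ⟦ y ⟧ ∣ < m
    distance<m = subst (_< m) (cong ∣_∣ (sym (ℤ.[+m]-[+n]≡m⊖n (toℕ x) (toℕ y))))
      (ℕ.≤-<-trans (ℤ.∣m⊝n∣≤m⊔n (toℕ x) (toℕ y)) (ℕ.⊔-lub (Fin.toℕ<n x) (Fin.toℕ<n y)))

altSum : ∀ {n} → (Fin n → ℤ) → ℤ
altSum {zero}  f = + 0
altSum {suc n} f = f Fin.zero - altSum (f ∘ Fin.suc)

altSum-cong : ∀ {n} {f g : Fin n → ℤ} → f ≗ g → altSum f ≡ altSum g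
altSum-cong {zero}  _   = refl
altSum-cong {suc n} f≗g = cong₂ _-_ (f≗g Fin.zero) (altSum-cong (f≗g ∘ Fin.suc))

σ≡altSum : ∀ {m n} (a : Tuple m n) → σ a ≡ altSum (⟦_⟧ ∘ a)
σ≡altSum {n = zero}  a = refl
σ≡altSum {n = suc n} a = cong (_-_ ⟦ a Fin.zero ⟧) (σ≡altSum (a ∘ Fin.suc))

σ-cong : ∀ {m n} {a b : Tuple m n} → a ≗ b → σ a ≡ σ b
σ-cong {a = a} {b} a≗b = begin
  σ a                ≡⟨ σ≡altSum a ⟩
  altSum (⟦_⟧ ∘ a)   ≡⟨ altSum-cong (cong ⟦_⟧ ∘ a≗b) ⟩
  altSum (⟦_⟧ ∘ b)   ≡⟨ σ≡altSum b ⟨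
  σ b                ∎
  where open ≡-Reasoning

altSum-+ : ∀ {n} (f g : Fin n → ℤ) → altSum (λ i → f i + g i) ≡ altSum f + altSum g
altSum-+ {zero}  f g = refl
altSum-+ {suc n} f g = trans
  (cong (_-_ (f Fin.zero + g Fin.zero)) (altSum-+ (f ∘ Fin.suc) (g ∘ Fin.suc)))
  (interchange (f Fin.zero) (g Fin.zero) (altSum (f ∘ Fin.suc)) (altSum (g ∘ Fin.suc)))
  where
  interchange : ∀ a b c d → (a + b) - (c + d) ≡ (a - c) + (b - d)
  interchange = solve-∀

altSum-- : ∀ {n} (f g : Fin n → ℤ) → altSum (λ i → f i - g i) ≡ altSum f - altSum g
altSum-- f g = trans (altSum-+ f (-_ ∘ g)) (cong (_+_ (altSum f)) (altSum-neg g))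
  where
  altSum-neg : ∀ {n} (g : Fin n → ℤ) → altSum (-_ ∘ g) ≡ - altSum g
  altSum-neg {zero}  g = refl
  altSum-neg {suc n} g = trans (cong (_-_ (- g Fin.zero)) (altSum-neg (g ∘ Fin.suc)))
    (neg-distrib (g Fin.zero) (altSum (g ∘ Fin.suc)))
    where
    neg-distrib : ∀ a s → - a - - s ≡ - (a - s)
    neg-distrib = solve-∀

altSum-cong-mod : ∀ {n k} {f g : Fin n → ℤ} → (∀ i → f i ≡ g i [mod k ]) →
                  altSum f ≡ altSum g [mod k ]
altSum-cong-mod {f = f} {g} f≡g = subst (+ _ ∣ₛ_) (altSum-- f g) (∣⇒∣altSum (λ i → f i - g i) f≡g)
  where
  ∣⇒∣altSum : ∀ {n k} (h : Fin n → ℤ) → (∀ i → k ∣ₛ h i) → k ∣ₛ altSum h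
  ∣⇒∣altSum {zero}  {k} _ _   = divides (+ 0) (sym (ℤ.*-zeroˡ k))
  ∣⇒∣altSum {suc n}     h k∣h = ∣m∣n⇒∣m-n (k∣h Fin.zero) (∣⇒∣altSum (h ∘ Fin.suc) (k∣h ∘ Fin.suc))

altSum-init-last : ∀ L (f : Fin (suc L) → ℤ) →
                   altSum f ≡ altSum (f ∘ inject₁) + iter L -_ (f (fromℕ L))
altSum-init-last zero    f = x-0≡0+x (f Fin.zero)
  where
  x-0≡0+x : ∀ x → x - + 0 ≡ + 0 + x
  x-0≡0+x = solve-∀
altSum-init-last (suc L) f = trans
  (cong (_-_ (f Fin.zero)) (altSum-init-last L (f ∘ Fin.suc)))
  (reassociate (f Fin.zero) (altSum (f ∘ Fin.suc ∘ inject₁)) (iter L -_ (f (fromℕ (suc L)))))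
  where
  reassociate : ∀ a s t → a - (s + t) ≡ (a - s) + - t
  reassociate = solve-∀

iter-neg-odd : ∀ k → suc k % 2 ≡ 0 → (x : ℤ) → iter k -_ x ≡ - x
iter-neg-odd (suc zero)    _    x = refl
iter-neg-odd (suc (suc k)) even x = trans (ℤ.neg-involutive (iter k -_ x)) (iter-neg-odd k even x)

nextIdx-inject₁ : ∀ {L} (i : Fin L) → nextIdx (inject₁ i) ≡ Fin.suc i
nextIdx-inject₁ {L} i = Fin.toℕ-injective (begin
  toℕ (nextIdx (inject₁ i))      ≡⟨ Fin.toℕ-fromℕ< _ ⟩
  suc (toℕ (inject₁ i)) % suc L  ≡⟨ cong (λ k → suc k % suc L) (Fin.toℕ-inject₁ i) ⟩
  suc (toℕ i) % suc L            ≡⟨ ℕ.m<n⇒m%n≡m (s<s (Fin.toℕ<n i)) ⟩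
  suc (toℕ i)                    ∎)
  where open ≡-Reasoning

nextIdx-fromℕ : ∀ L → nextIdx (fromℕ L) ≡ Fin.zero
nextIdx-fromℕ L = Fin.toℕ-injective (begin
  toℕ (nextIdx (fromℕ L))        ≡⟨ Fin.toℕ-fromℕ< _ ⟩
  suc (toℕ (fromℕ L)) % suc L    ≡⟨ cong (λ k → suc k % suc L) (Fin.toℕ-fromℕ L) ⟩
  suc L % suc L                  ≡⟨ ℕ.n%n≡0 (suc L) ⟩
  0                              ∎)
  where open ≡-Reasoning

altSum-rotate : ∀ {L} → suc L % 2 ≡ 0 → (f : Fin (suc L) → ℤ) → altSum (f ∘ nextIdx) ≡ - altSum f
altSum-rotate {L} even f = begin
  altSum (f ∘ nextIdx)
    ≡⟨ altSum-init-last L (f ∘ nextIdx) ⟩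
  altSum (f ∘ nextIdx ∘ inject₁) + iter L -_ (f (nextIdx (fromℕ L)))
    ≡⟨ cong₂ _+_ (altSum-cong (cong f ∘ nextIdx-inject₁)) (cong (iter L -_ ∘ f) (nextIdx-fromℕ L)) ⟩
  altSum (f ∘ Fin.suc) + iter L -_ (f Fin.zero)
    ≡⟨ cong (_+_ (altSum (f ∘ Fin.suc))) (iter-neg-odd L even (f Fin.zero)) ⟩
  altSum (f ∘ Fin.suc) + - f Fin.zero
    ≡⟨ swap-neg (f Fin.zero) (altSum (f ∘ Fin.suc)) ⟩
  - altSum f
    ∎
  where
  open ≡-Reasoning
  swap-neg : ∀ a s → s + - a ≡ - (a - s)
  swap-neg = solve-∀

altSum-neighbourSums : ∀ {L} → suc L % 2 ≡ 0 → (f : Fin (suc L) → ℤ) →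
                       altSum (λ i → f i + f (nextIdx i)) ≡ + 0
altSum-neighbourSums even f = begin
  altSum (λ i → f i + f (nextIdx i))   ≡⟨ altSum-+ f (f ∘ nextIdx) ⟩
  altSum f + altSum (f ∘ nextIdx)      ≡⟨ cong (_+_ (altSum f)) (altSum-rotate even f) ⟩
  altSum f + - altSum f                ≡⟨ ℤ.+-inverseʳ (altSum f) ⟩
  + 0                                  ∎
  where open ≡-Reasoning

AlternatingMod : ℕ → ∀ {L} → (Fin (suc L) → ℤ) → Set
AlternatingMod k {L} d = ∀ (i : Fin L) → + k ∣ₛ d (inject₁ i) + d (Fin.suc i)

module _ {k : ℕ} where

  altSum-alternatingMod : ∀ {L} (d : Fin (suc L) → ℤ) → AlternatingMod k d →
                          altSum d ≡ + suc L * d Fin.zero [mod k ]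
  altSum-alternatingMod {zero}  d _   = divides (+ 0) (x-0-1x≡0k (d Fin.zero) (+ k))
    where
    x-0-1x≡0k : ∀ x k → (x - + 0) - + 1 * x ≡ + 0 * k
    x-0-1x≡0k = solve-∀
  altSum-alternatingMod {suc L} d alt = subst (+ k ∣ₛ_)
    (regroup (d Fin.zero) (d (Fin.suc Fin.zero)) (altSum (d ∘ Fin.suc)) (+ suc L))
    (∣m∣n⇒∣m-n (∣m⇒∣-m (altSum-alternatingMod (d ∘ Fin.suc) (alt ∘ Fin.suc)))
               (∣n⇒∣m*n (+ suc L) (alt Fin.zero)))
    where
    regroup : ∀ a b s l → - (s - l * b) - l * (a + b) ≡ (a - s) - (+ 1 + l) * a
    regroup = solve-∀

  alternatingMod-∣head⇒∣ : ∀ {L} (d : Fin (suc L) → ℤ) → AlternatingMod k d →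
                           + k ∣ₛ d Fin.zero → ∀ i → + k ∣ₛ d i
  alternatingMod-∣head⇒∣         d _   k∣d₀ Fin.zero    = k∣d₀
  alternatingMod-∣head⇒∣ {suc L} d alt k∣d₀ (Fin.suc i) =
    alternatingMod-∣head⇒∣ (d ∘ Fin.suc) (alt ∘ Fin.suc) (∣m+n∣m⇒∣n (alt Fin.zero) k∣d₀) i

  alternatingMod-vanishes : ∀ {L} (d : Fin (suc L) → ℤ) → Coprime k (suc L) →
                            AlternatingMod k d → + k ∣ₛ altSum d → ∀ i → + k ∣ₛ d i
  alternatingMod-vanishes {L} d coprime alt k∣altSum = alternatingMod-∣head⇒∣ d alt
    (∣ᵤ⇒∣ (ℤ.coprime-divisor (+ k) (+ suc L) (d Fin.zero) coprime (∣⇒∣ᵤ k∣n*d₀)))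
    where
    x-[x-y]≡y : ∀ x y → x - (x - y) ≡ y
    x-[x-y]≡y = solve-∀
    k∣n*d₀ : + k ∣ₛ + suc L * d Fin.zero
    k∣n*d₀ = subst (+ k ∣ₛ_) (x-[x-y]≡y (altSum d) _)
      (∣m∣n⇒∣m-n k∣altSum (altSum-alternatingMod d alt))

module _ {m L : ℕ} .{{_ : NonZero m}} where

  ⟦T⟧ : (a : Tuple m (suc L)) → ∀ i → ⟦ T a i ⟧ ≡ ⟦ a i ⟧ + ⟦ a (nextIdx i) ⟧ [mod m ]
  ⟦T⟧ a i = ⟦+ₘ⟧ (a i) (a (nextIdx i))

  σ-T : suc L % 2 ≡ 0 → (b : Tuple m (suc L)) → + m ∣ₛ σ (T b)
  σ-T even b = subst (+ m ∣ₛ_) difference≡σTb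
    (altSum-cong-mod {f = ⟦_⟧ ∘ T b} {g = neighbourSums} (⟦T⟧ b))
    where
    neighbourSums : Fin (suc L) → ℤ
    neighbourSums i = ⟦ b i ⟧ + ⟦ b (nextIdx i) ⟧
    difference≡σTb : altSum (⟦_⟧ ∘ T b) - altSum neighbourSums ≡ σ (T b)
    difference≡σTb = trans (cong₂ _-_ (sym (σ≡altSum (T b))) (altSum-neighbourSums even (⟦_⟧ ∘ b)))
                      (ℤ.+-identityʳ (σ (T b)))

  T-injective-on-kerσ : Coprime m (suc L) → {a b : Tuple m (suc L)} →
                        + m ∣ₛ σ a → + m ∣ₛ σ b → T a ≗ T b → a ≗ b
  T-injective-on-kerσ coprime {a} {b} m∣σa m∣σb Ta≗Tb i =
    ⟦⟧-injective-mod (alternatingMod-vanishes d coprime d-alternating m∣altSum-d i)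
    where
    d : Fin (suc L) → ℤ
    d i = ⟦ a i ⟧ - ⟦ b i ⟧
    m∣altSum-d : + m ∣ₛ altSum d
    m∣altSum-d = subst (+ m ∣ₛ_)
      (trans (cong₂ _-_ (σ≡altSum a) (σ≡altSum b)) (sym (altSum-- (⟦_⟧ ∘ a) (⟦_⟧ ∘ b))))
      (∣m∣n⇒∣m-n m∣σa m∣σb)
    ⟦T⟧-inject₁ : ∀ c j → ⟦ T c (inject₁ j) ⟧ ≡ ⟦ c (inject₁ j) ⟧ + ⟦ c (Fin.suc j) ⟧ [mod m ]
    ⟦T⟧-inject₁ c j = subst (λ k → ⟦ T c (inject₁ j) ⟧ ≡ ⟦ c (inject₁ j) ⟧ + ⟦ c k ⟧ [mod m ])
      (nextIdx-inject₁ j) (⟦T⟧ c (inject₁ j))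
    regroup : ∀ t a₁ a₂ b₁ b₂ → (t - (b₁ + b₂)) - (t - (a₁ + a₂)) ≡ (a₁ - b₁) + (a₂ - b₂)
    regroup = solve-∀
    d-alternating : AlternatingMod m d
    d-alternating j = subst (+ m ∣ₛ_)
      (regroup ⟦ T b (inject₁ j) ⟧ a₁ a₂ ⟦ b (inject₁ j) ⟧ ⟦ b (Fin.suc j) ⟧)
      (∣m∣n⇒∣m-n (⟦T⟧-inject₁ b j) Tbⱼ≡a₁+a₂)
      where
      a₁ = ⟦ a (inject₁ j) ⟧
      a₂ = ⟦ a (Fin.suc j) ⟧
      Tbⱼ≡a₁+a₂ : ⟦ T b (inject₁ j) ⟧ ≡ a₁ + a₂ [mod m ]
      Tbⱼ≡a₁+a₂ = subst (λ t → ⟦ t ⟧ ≡ a₁ + a₂ [mod m ]) (Ta≗Tb (inject₁ j)) (⟦T⟧-inject₁ a j)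

funToFin-injective : ∀ {m n} → Injective _≗_ _≡_ (funToFin {m} {n})
funToFin-injective {x = f} {g} f≡g i = begin
  f i                       ≡⟨ Fin.finToFun-funToFin f i ⟨
  finToFun (funToFin f) i   ≡⟨ cong (λ c → finToFun c i) f≡g ⟩
  finToFun (funToFin g) i   ≡⟨ Fin.finToFun-funToFin g i ⟩
  g i                       ∎
  where open ≡-Reasoning

module _ {ℓ} (S : Setoid 0ℓ ℓ) where
  open Setoid S using (Carrier; _≈_) renaming (sym to ≈-sym)

  module _ {p} (f : Carrier → Carrier) (P : Pred Carrier p) (P-invariant : ∀ {x} → P x → P (f x))
           (injectiveOn : ∀ {x y} → P x → P y → f x ≈ f y → x ≈ y) where

    iter-invariant : ∀ {x} → P x → ∀ k → P (iter k f x)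
    iter-invariant Px zero    = Px
    iter-invariant Px (suc k) = P-invariant (iter-invariant Px k)

    iter-cancel : ∀ {x} → P x → ∀ i {q} → iter i f x ≈ iter (i ℕ.+ q) f x → x ≈ iter q f x
    iter-cancel Px zero    eq = eq
    iter-cancel Px (suc i) eq =
      iter-cancel Px i (injectiveOn (iter-invariant Px i) (iter-invariant Px (i ℕ.+ _)) eq)

    finite-injectiveOn⇒periodic : ∀ {N} {code : Carrier → Fin N} → Injective _≈_ _≡_ code →
                                  ∀ {x} → P x → ∃[ j ] (0 < j × iter j f x ≈ x)
    finite-injectiveOn⇒periodic {N} {code} code-injective {x} Px =
      let i , j , i<j , codeᵢ≡codeⱼ = Fin.pigeonhole (ℕ.n<1+n N) (λ k → code (iter (toℕ k) f x))
          j≡i+[j∸i] = sym (ℕ.m+[n∸m]≡n (ℕ.<⇒≤ i<j))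
      in toℕ j ℕ.∸ toℕ i , ℕ.m<n⇒0<n∸m i<j ,
         ≈-sym (iter-cancel Px (toℕ i)
           (subst (λ k → iter (toℕ i) f x ≈ iter k f x) j≡i+[j∸i] (code-injective codeᵢ≡codeⱼ)))

proposition6p2 : (m n : ℕ) → .{{_ : NonZero m}} → .{{_ : NonZero n}} →
    m > 2 → m % 2 ≡ 1 → n > 0 → n % 2 ≡ 0 → gcd m n ≡ 1 →
    (a : Tuple m n) → InCycle a ⇔ ((+ m) ∣ σ a)
proposition6p2 m (suc L) _ _ _ even gcd≡1 a = mk⇔ onCycle⇒m∣σ m∣σ⇒onCycle
  where
  onCycle⇒m∣σ : InCycle a → + m ∣ σ a
  onCycle⇒m∣σ (suc j , _ , Tʲ⁺¹a≗a) =
    ∣⇒∣ᵤ (subst (+ m ∣ₛ_) (σ-cong Tʲ⁺¹a≗a) (σ-T even (iter j T a)))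
  m∣σ⇒onCycle : + m ∣ σ a → InCycle a
  m∣σ⇒onCycle m∣σa = finite-injectiveOn⇒periodic (Fin (suc L) →-setoid Zmod m) T (λ b → + m ∣ₛ σ b)
    (λ {b} _ → σ-T even b) (T-injective-on-kerσ (gcd≡1⇒coprime gcd≡1)) funToFin-injective (∣ᵤ⇒∣ m∣σa)
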